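{- Let $\mathcal{D}$ be a Ryser design of order $v$ and index $\lambda$, with replication numbers $r_1>r_2$, let $e_i$ be the number of points with replication number $r_i$ ($i=1,2$), and let $D=e_1-r_2$. Then $v\ge 4\lambda-1$ if and only if $e_2-e_1\ge 2D+1$.
   Context: A Ryser design of order $v$ and index $\lambda$ is a pair $(X,L)$ where $X$ is a set of $v$ points and $L$ is a collection of $v$ subsets (blocks) of $X$ such that any two distinct blocks meet in exactly $\lambda$ points, every block has size $>\lambda$, and there exist two blocks of different sizes. It is known that there are integers $r_1>r_2$ with $r_1+r_2=v+1$ such that every point lies in exactly $r_1$ or exactly $r_2$ blocks. -}

module Defs where

open import Data.Nat using (ℕ; _<_)
open import Data.Nat.Properties using (_≟_)
open import Data.Fin using (Fin)
open import Data.Fin.Subset using (Subset; _∩_; ∣_∣)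
open import Data.Vec using (tabulate; lookup)
open import Data.Product using (_×_; ∃₂)
open import Relation.Nullary using (¬_; does)
open import Relation.Binary.PropositionalEquality using (_≡_)

Blocks : ℕ → Set
Blocks v = Fin v → Subset v

record IsRyserDesign (v λ′ : ℕ) (B : Blocks v) : Set where
  field
    intersect : ∀ (i j : Fin v) → ¬ (i ≡ j) → ∣ B i ∩ B j ∣ ≡ λ′
    bigBlocks : ∀ (i : Fin v) → λ′ < ∣ B i ∣
    twoSizes  : ∃₂ λ (i j : Fin v) → ¬ (∣ B i ∣ ≡ ∣ B j ∣)

replication : ∀ {v} → Blocks v → Fin v → ℕ
replication {v} B x = ∣ tabulate (λ j → lookup (B j) x) ∣

pointsWithRep : ∀ {v} → Blocks v → ℕ → ℕ
pointsWithRep {v} B r = ∣ tabulate (λ x → does (replication B x ≟ r)) ∣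

-- Let rₓ be the replication number of the point x, and e₁, e₂ the
-- numbers of points with rₓ = r₁, resp. rₓ = r₂. Double counting incidences
-- gives Σₓ rₓ = Σⱼ |Bⱼ| and Σₓ rₓ² = Σᵢ Σⱼ |Bᵢ ∩ Bⱼ|; as distinct blocks meet
-- in λ points, Σₓ rₓ² + vλ = Σₓ rₓ + v²λ. Grouping points by replication
-- class turns this into  e₁r₁² + e₂r₂² + vλ = e₁r₁ + e₂r₂ + v²λ,  while
-- e₁ + e₂ = v. Over ℤ, with r₁ + r₂ = v + 1, these are equivalent to the
-- linear relation
--   (v − 1)(v + 1 − 4λ) = (r₁ − r₂)((e₂ − e₁) − (2(e₁ − r₂) + 1)),
-- and since v − 1 > 0 (a Ryser design has two distinct blocks) and
-- r₁ − r₂ > 0, both sides' second factors have the same sign, which is the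
-- corollary.

module Submission where

open import Defs

module Counting where

  open import Data.Bool using (Bool; true; false; _∧_)
  open import Data.Fin using (Fin; zero; suc)
  open import Data.Fin.Properties using (suc-injective)
  open import Data.Fin.Subset using (Subset; _∩_; ∣_∣)
  open import Data.Fin.Subset.Properties using (∩-idem)
  open import Data.Nat using (ℕ; zero; suc; _+_; _*_; _≤_; s≤s; z≤n)
  open import Data.Nat.Properties using (+-*-semiring; _≟_; +-assoc; +-identityʳ; *-identityʳ)
  open import Data.Nat.Tactic.RingSolver using (solve-∀)
  open import Data.Sum using (_⊎_; inj₁; inj₂)
  open import Data.Vec using (_∷_; []; tabulate; lookup)
  open import Data.Vec.Properties using (lookup∘tabulate; lookup-zipWith)
  open import Function using (_∘_)
  open import Relation.Binary.PropositionalEquality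
  open import Relation.Nullary using (does; contradiction)
  open import Relation.Nullary.Decidable using (dec-true; dec-false)
  open import Algebra.Properties.Semiring.Sum +-*-semiring
    using (sum; sum-syntax; sum-cong-≗; ∑-comm; ∑-distrib-+; *-distribˡ-sum; *-distribʳ-sum)
  open ≡-Reasoning

  ∑-const : ∀ n c → ∑[ i < n ] c ≡ n * c
  ∑-const zero    c = refl
  ∑-const (suc n) c = cong (c +_) (∑-const n c)

  ∑-*-∑ : ∀ {m n} (f : Fin m → ℕ) (g : Fin n → ℕ) →
    sum f * sum g ≡ ∑[ i < m ] ∑[ j < n ] (f i * g j)
  ∑-*-∑ {m} {n} f g = begin
    sum f * sum g                         ≡⟨ *-distribʳ-sum (sum g) f ⟩
    ∑[ i < m ] (f i * sum g)              ≡⟨ sum-cong-≗ (λ i → *-distribˡ-sum (f i) g) ⟩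
    ∑[ i < m ] ∑[ j < n ] (f i * g j)     ∎

  ∑-spike : ∀ {n} (i : Fin n) (f : Fin n → ℕ) {k c} →
    f i ≡ k → (∀ j → i ≢ j → f j ≡ c) → sum f + c ≡ k + n * c
  ∑-spike {suc n} zero f {k} {c} fi≡k rest = begin
    f zero + sum (f ∘ suc) + c   ≡⟨ cong₂ (λ a b → a + b + c) fi≡k off-diagonal ⟩
    k + n * c + c                ≡⟨ regroup k n c ⟩
    k + suc n * c                ∎
    where
    regroup : ∀ k n c → k + n * c + c ≡ k + suc n * c
    regroup = solve-∀
    off-diagonal : sum (f ∘ suc) ≡ n * c
    off-diagonal = trans (sum-cong-≗ (λ j → rest (suc j) λ ())) (∑-const n c)
  ∑-spike {suc n} (suc i) f {k} {c} fi≡k rest = begin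
    f zero + sum (f ∘ suc) + c   ≡⟨ +-assoc (f zero) _ c ⟩
    f zero + (sum (f ∘ suc) + c) ≡⟨ cong₂ _+_ (rest zero λ ()) (∑-spike i (f ∘ suc) fi≡k rest-tail) ⟩
    c + (k + n * c)              ≡⟨ regroup k n c ⟩
    k + suc n * c                ∎
    where
    rest-tail : ∀ j → i ≢ j → f (suc j) ≡ c
    rest-tail j i≢j = rest (suc j) (i≢j ∘ suc-injective)
    regroup : ∀ k n c → c + (k + n * c) ≡ k + suc n * c
    regroup = solve-∀

  indicator : Bool → ℕ
  indicator true  = 1
  indicator false = 0

  indicator-∧ : ∀ a b → indicator (a ∧ b) ≡ indicator a * indicator b
  indicator-∧ true  b = sym (+-identityʳ (indicator b))
  indicator-∧ false b = refl

  ∣p∣≡∑ : ∀ {n} (p : Subset n) → ∣ p ∣ ≡ ∑[ x < n ] indicator (lookup p x)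
  ∣p∣≡∑ []          = refl
  ∣p∣≡∑ (true ∷ p)  = cong suc (∣p∣≡∑ p)
  ∣p∣≡∑ (false ∷ p) = ∣p∣≡∑ p

  ∣tabulate∣≡∑ : ∀ {n} (f : Fin n → Bool) → ∣ tabulate f ∣ ≡ ∑[ x < n ] indicator (f x)
  ∣tabulate∣≡∑ f = trans (∣p∣≡∑ (tabulate f)) (sum-cong-≗ (cong indicator ∘ lookup∘tabulate f))

  fibreSize : ∀ {n} → (Fin n → ℕ) → ℕ → ℕ
  fibreSize f a = ∣ tabulate (λ x → does (f x ≟ a)) ∣

  select-value : ∀ {a b c} (h : ℕ → ℕ) → a ≢ b → c ≡ a ⊎ c ≡ b →
    h c ≡ indicator (does (c ≟ a)) * h a + indicator (does (c ≟ b)) * h b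
  select-value {a} {b} h a≢b (inj₁ refl)
    rewrite dec-true (a ≟ a) refl | dec-false (a ≟ b) a≢b =
      sym (trans (+-identityʳ _) (+-identityʳ _))
  select-value {a} {b} h a≢b (inj₂ refl)
    rewrite dec-false (b ≟ a) (a≢b ∘ sym) | dec-true (b ≟ b) refl =
      sym (+-identityʳ _)

  ∑-two-valued : ∀ {n} (f : Fin n → ℕ) {a b} → a ≢ b → (∀ x → f x ≡ a ⊎ f x ≡ b) →
    (h : ℕ → ℕ) → ∑[ x < n ] h (f x) ≡ fibreSize f a * h a + fibreSize f b * h b
  ∑-two-valued {n} f {a} {b} a≢b two-valued h = begin
    ∑[ x < n ] h (f x)
      ≡⟨ sum-cong-≗ (λ x → select-value h a≢b (two-valued x)) ⟩
    ∑[ x < n ] (χ a x * h a + χ b x * h b)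
      ≡⟨ ∑-distrib-+ (λ x → χ a x * h a) (λ x → χ b x * h b) ⟩
    ∑[ x < n ] (χ a x * h a) + ∑[ x < n ] (χ b x * h b)
      ≡⟨ sym (cong₂ _+_ (*-distribʳ-sum (h a) (χ a)) (*-distribʳ-sum (h b) (χ b))) ⟩
    sum (χ a) * h a + sum (χ b) * h b
      ≡⟨ sym (cong₂ _+_ (cong (_* h a) (∣tabulate∣≡∑ (in-fibre a)))
                        (cong (_* h b) (∣tabulate∣≡∑ (in-fibre b)))) ⟩
    fibreSize f a * h a + fibreSize f b * h b
      ∎
    where
    in-fibre : ℕ → Fin n → Bool
    in-fibre c x = does (f x ≟ c)
    χ : ℕ → Fin n → ℕ
    χ c = indicator ∘ in-fibre c

  fibres-partition : ∀ {n} (f : Fin n → ℕ) {a b} → a ≢ b → (∀ x → f x ≡ a ⊎ f x ≡ b) →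
    fibreSize f a + fibreSize f b ≡ n
  fibres-partition {n} f {a} {b} a≢b two-valued = begin
    fibreSize f a + fibreSize f b
      ≡⟨ sym (cong₂ _+_ (*-identityʳ (fibreSize f a)) (*-identityʳ (fibreSize f b))) ⟩
    fibreSize f a * 1 + fibreSize f b * 1
      ≡⟨ sym (∑-two-valued f a≢b two-valued (λ _ → 1)) ⟩
    ∑[ x < n ] 1
      ≡⟨ ∑-const n 1 ⟩
    n * 1
      ≡⟨ *-identityʳ n ⟩
    n
      ∎

  module Incidence {v : ℕ} (B : Blocks v) where

    incidence : Fin v → Fin v → ℕ
    incidence x j = indicator (lookup (B j) x)

    replication≡∑ : ∀ x → replication B x ≡ ∑[ j < v ] incidence x j
    replication≡∑ x = ∣tabulate∣≡∑ (λ j → lookup (B j) x)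

    size≡∑ : ∀ j → ∣ B j ∣ ≡ ∑[ x < v ] incidence x j
    size≡∑ j = ∣p∣≡∑ (B j)

    intersection≡∑ : ∀ i j → ∣ B i ∩ B j ∣ ≡ ∑[ x < v ] (incidence x i * incidence x j)
    intersection≡∑ i j = trans (∣p∣≡∑ (B i ∩ B j)) (sum-cong-≗ λ x →
      trans (cong indicator (lookup-zipWith _∧_ x (B i) (B j)))
            (indicator-∧ (lookup (B i) x) (lookup (B j) x)))

    ∑replication≡∑size : ∑[ x < v ] replication B x ≡ ∑[ j < v ] ∣ B j ∣
    ∑replication≡∑size = begin
      ∑[ x < v ] replication B x              ≡⟨ sum-cong-≗ replication≡∑ ⟩
      ∑[ x < v ] ∑[ j < v ] incidence x j     ≡⟨ ∑-comm incidence ⟩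
      ∑[ j < v ] ∑[ x < v ] incidence x j     ≡⟨ sym (sum-cong-≗ size≡∑) ⟩
      ∑[ j < v ] ∣ B j ∣                      ∎

    ∑replication²≡∑intersections :
      ∑[ x < v ] (replication B x * replication B x) ≡ ∑[ i < v ] ∑[ j < v ] ∣ B i ∩ B j ∣
    ∑replication²≡∑intersections = begin
      ∑[ x < v ] (replication B x * replication B x)
        ≡⟨ sum-cong-≗ (λ x → trans (cong₂ _*_ (replication≡∑ x) (replication≡∑ x))
                                   (∑-*-∑ (incidence x) (incidence x))) ⟩
      ∑[ x < v ] ∑[ i < v ] ∑[ j < v ] (incidence x i * incidence x j)
        ≡⟨ ∑-comm (λ x i → ∑[ j < v ] (incidence x i * incidence x j)) ⟩
      ∑[ i < v ] ∑[ x < v ] ∑[ j < v ] (incidence x i * incidence x j)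
        ≡⟨ sum-cong-≗ (λ i → ∑-comm (λ x j → incidence x i * incidence x j)) ⟩
      ∑[ i < v ] ∑[ j < v ] ∑[ x < v ] (incidence x i * incidence x j)
        ≡⟨ sym (sum-cong-≗ λ i → sum-cong-≗ (intersection≡∑ i)) ⟩
      ∑[ i < v ] ∑[ j < v ] ∣ B i ∩ B j ∣
        ∎

  ∑replication²-identity : ∀ {v λ′} (B : Blocks v) →
    (∀ i j → i ≢ j → ∣ B i ∩ B j ∣ ≡ λ′) →
    ∑[ x < v ] (replication B x * replication B x) + v * λ′
      ≡ ∑[ x < v ] replication B x + v * (v * λ′)
  ∑replication²-identity {v} {λ′} B intersect = begin
    ∑[ x < v ] (replication B x * replication B x) + v * λ′
      ≡⟨ cong₂ _+_ ∑replication²≡∑intersections (sym (∑-const v λ′)) ⟩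
    ∑[ i < v ] ∑[ j < v ] ∣ B i ∩ B j ∣ + ∑[ i < v ] λ′
      ≡⟨ sym (∑-distrib-+ (λ i → ∑[ j < v ] ∣ B i ∩ B j ∣) (λ _ → λ′)) ⟩
    ∑[ i < v ] (∑[ j < v ] ∣ B i ∩ B j ∣ + λ′)
      ≡⟨ sum-cong-≗ row-sum ⟩
    ∑[ i < v ] (∣ B i ∣ + v * λ′)
      ≡⟨ ∑-distrib-+ (λ i → ∣ B i ∣) (λ _ → v * λ′) ⟩
    ∑[ i < v ] ∣ B i ∣ + ∑[ i < v ] (v * λ′)
      ≡⟨ cong₂ _+_ (sym ∑replication≡∑size) (∑-const v (v * λ′)) ⟩
    ∑[ x < v ] replication B x + v * (v * λ′)
      ∎
    where
    open Incidence B
    -- Row i of the intersection matrix: |B i| on the diagonal, λ′ elsewhere.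
    row-sum : ∀ i → ∑[ j < v ] ∣ B i ∩ B j ∣ + λ′ ≡ ∣ B i ∣ + v * λ′
    row-sum i = ∑-spike i (λ j → ∣ B i ∩ B j ∣) (cong ∣_∣ (∩-idem (B i))) (intersect i)

  distinct⇒2≤n : ∀ {n} {i j : Fin n} → i ≢ j → 2 ≤ n
  distinct⇒2≤n {suc (suc n)}                   _   = s≤s (s≤s z≤n)
  distinct⇒2≤n {suc zero}    {zero} {zero} i≢j = contradiction refl i≢j

  class-sizes : ∀ {v r₁ r₂} (B : Blocks v) → r₁ ≢ r₂ →
    (∀ x → replication B x ≡ r₁ ⊎ replication B x ≡ r₂) →
    pointsWithRep B r₁ + pointsWithRep B r₂ ≡ v
  class-sizes B = fibres-partition (replication B)

  class-counting : ∀ {v λ′ r₁ r₂} (B : Blocks v) →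
    (∀ i j → i ≢ j → ∣ B i ∩ B j ∣ ≡ λ′) → r₁ ≢ r₂ →
    (∀ x → replication B x ≡ r₁ ⊎ replication B x ≡ r₂) →
    let e₁ = pointsWithRep B r₁; e₂ = pointsWithRep B r₂ in
    e₁ * (r₁ * r₁) + e₂ * (r₂ * r₂) + v * λ′ ≡ e₁ * r₁ + e₂ * r₂ + v * (v * λ′)
  class-counting {v} {λ′} {r₁} {r₂} B intersect r₁≢r₂ classes = begin
    e₁ * (r₁ * r₁) + e₂ * (r₂ * r₂) + v * λ′
      ≡⟨ cong (_+ v * λ′) (∑-two-valued (replication B) r₁≢r₂ classes (λ r → r * r)) ⟨
    ∑[ x < v ] (replication B x * replication B x) + v * λ′
      ≡⟨ ∑replication²-identity B intersect ⟩
    ∑[ x < v ] replication B x + v * (v * λ′)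
      ≡⟨ cong (_+ v * (v * λ′)) (∑-two-valued (replication B) r₁≢r₂ classes (λ r → r)) ⟩
    e₁ * r₁ + e₂ * r₂ + v * (v * λ′)
      ∎
    where
    e₁ e₂ : ℕ
    e₁ = pointsWithRep B r₁
    e₂ = pointsWithRep B r₂

module IntegerAlgebra where

  open import Data.List using (_∷_; [])
  import Data.Nat as ℕ
  import Data.Nat.Properties as ℕ
  open import Data.Integer
  open import Data.Integer.Properties
  open import Data.Integer.Tactic.RingSolver using (solve)
  open import Function.Bundles using (_⇔_; mk⇔)
  open import Relation.Binary.PropositionalEquality

  0<n-m : ∀ {m n} → m ℕ.< n → 0ℤ < + n - + m
  0<n-m {m} {n} m<n = subst (0ℤ <_) (sym (trans (m-n≡m⊖n n m) (⊖-≥ (ℕ.<⇒≤ m<n))))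
    (+<+ (ℕ.m<n⇒0<n∸m m<n))

  ≤⇔0≤- : ∀ {x y} → x ≤ y ⇔ 0ℤ ≤ y - x
  ≤⇔0≤- = mk⇔ i≤j⇒0≤j-i 0≤i-j⇒j≤i

  nonneg-transfer : ∀ {p q a b} → 0ℤ ≤ p → 0ℤ < q → p * a ≡ q * b → 0ℤ ≤ a → 0ℤ ≤ b
  nonneg-transfer {p} {q} {a} {b} 0≤p 0<q pa≡qb 0≤a =
    *-cancelˡ-≤-pos 0ℤ b q {{positive 0<q}} (begin
      q * 0ℤ  ≡⟨ *-zeroʳ q ⟩
      0ℤ      ≡⟨ *-zeroʳ p ⟨
      p * 0ℤ  ≤⟨ *-monoˡ-≤-nonNeg p {{nonNegative 0≤p}} 0≤a ⟩
      p * a   ≡⟨ pa≡qb ⟩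
      q * b   ∎)
    where open ≤-Reasoning

  same-sign : ∀ {p q a b} → 0ℤ < p → 0ℤ < q → p * a ≡ q * b → (0ℤ ≤ a ⇔ 0ℤ ≤ b)
  same-sign 0<p 0<q pa≡qb =
    mk⇔ (nonneg-transfer (<⇒≤ 0<p) 0<q pa≡qb) (nonneg-transfer (<⇒≤ 0<q) 0<p (sym pa≡qb))

  ryser-identity : ∀ (e₁ e₂ r₁ r₂ v λ′ : ℤ) .{{_ : NonZero v}} →
    v ≡ e₁ + e₂ → r₁ ≡ + 1 + v - r₂ →
    e₁ * (r₁ * r₁) + e₂ * (r₂ * r₂) + v * λ′ ≡ e₁ * r₁ + e₂ * r₂ + v * (v * λ′) →
    (v - + 1) * ((+ 1 + v) - + 4 * λ′) ≡ (r₁ - r₂) * ((e₂ - e₁) - (+ 2 * (e₁ - r₂) + + 1))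
  ryser-identity e₁ e₂ r₁ r₂ v λ′ refl refl counting =
    *-cancelˡ-≡ v _ _ (i-j≡0⇒i≡j _ _ (begin
      v * ((v - + 1) * ((+ 1 + v) - + 4 * λ′))
        - v * ((r₁ - r₂) * ((e₂ - e₁) - (+ 2 * (e₁ - r₂) + + 1)))  ≡⟨ expansion ⟩
      + 4 * (counting-lhs - counting-rhs)                           ≡⟨ cong (+ 4 *_) (i≡j⇒i-j≡0 counting) ⟩
      + 4 * 0ℤ                                                      ≡⟨ *-zeroʳ (+ 4) ⟩
      0ℤ                                                            ∎))
    where
    open ≡-Reasoning
    counting-lhs counting-rhs : ℤ
    counting-lhs = e₁ * (r₁ * r₁) + e₂ * (r₂ * r₂) + v * λ′
    counting-rhs = e₁ * r₁ + e₂ * r₂ + v * (v * λ′)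
    -- After substituting v and r₁ this is a polynomial identity in e₁, e₂, r₂, λ′.
    expansion : v * ((v - + 1) * ((+ 1 + v) - + 4 * λ′))
                  - v * ((r₁ - r₂) * ((e₂ - e₁) - (+ 2 * (e₁ - r₂) + + 1)))
                ≡ + 4 * ((e₁ * (r₁ * r₁) + e₂ * (r₂ * r₂) + v * λ′)
                         - (e₁ * r₁ + e₂ * r₂ + v * (v * λ′)))
    expansion = solve (e₁ ∷ e₂ ∷ r₂ ∷ λ′ ∷ [])

  a≡c-b : ∀ {a b c : ℤ} → a + b ≡ c → a ≡ c - b
  a≡c-b {a} {b} refl = solve (a ∷ b ∷ [])

  ℕ≤⇔ℤ≤ : ∀ {m n} → m ℕ.≤ n ⇔ + m ≤ + n
  ℕ≤⇔ℤ≤ = mk⇔ +≤+ drop‿+≤+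

  pos-*-* : ∀ a b c → + (a ℕ.* (b ℕ.* c)) ≡ + a * (+ b * + c)
  pos-*-* a b c = trans (pos-* a (b ℕ.* c)) (cong (+ a *_) (pos-* b c))

  counting-in-ℤ : ∀ e₁ e₂ r₁ r₂ v λ′ →
    e₁ ℕ.* (r₁ ℕ.* r₁) ℕ.+ e₂ ℕ.* (r₂ ℕ.* r₂) ℕ.+ v ℕ.* λ′
      ≡ e₁ ℕ.* r₁ ℕ.+ e₂ ℕ.* r₂ ℕ.+ v ℕ.* (v ℕ.* λ′) →
    + e₁ * (+ r₁ * + r₁) + + e₂ * (+ r₂ * + r₂) + + v * + λ′
      ≡ + e₁ * + r₁ + + e₂ * + r₂ + + v * (+ v * + λ′)
  counting-in-ℤ e₁ e₂ r₁ r₂ v λ′ eq = trans (sym lhs) (trans (cong +_ eq) rhs)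
    where
    lhs : + (e₁ ℕ.* (r₁ ℕ.* r₁) ℕ.+ e₂ ℕ.* (r₂ ℕ.* r₂) ℕ.+ v ℕ.* λ′)
          ≡ + e₁ * (+ r₁ * + r₁) + + e₂ * (+ r₂ * + r₂) + + v * + λ′
    lhs = cong₂ _+_ (cong₂ _+_ (pos-*-* e₁ r₁ r₁) (pos-*-* e₂ r₂ r₂)) (pos-* v λ′)
    rhs : + (e₁ ℕ.* r₁ ℕ.+ e₂ ℕ.* r₂ ℕ.+ v ℕ.* (v ℕ.* λ′))
          ≡ + e₁ * + r₁ + + e₂ * + r₂ + + v * (+ v * + λ′)
    rhs = cong₂ _+_ (cong₂ _+_ (pos-* e₁ r₁) (pos-* e₂ r₂)) (pos-*-* v v λ′)

open Counting using (distinct⇒2≤n; class-sizes; class-counting)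
open IntegerAlgebra
  using (0<n-m; ≤⇔0≤-; same-sign; ryser-identity; a≡c-b; ℕ≤⇔ℤ≤; counting-in-ℤ)

open import Data.Nat using (ℕ; _+_; _*_; _<_; _≤_; suc; z<s)
import Data.Nat.Properties as ℕ
open import Data.Integer using (+_; _-_; >-nonZero; +<+) renaming (_+_ to _+ℤ_; _*_ to _*ℤ_; _≤_ to _≤ℤ_)
open import Data.Integer.Properties using (pos-*)
open import Data.Fin using (Fin)
open import Data.Fin.Subset using (∣_∣)
open import Data.Product using (_,_)
open import Data.Sum using (_⊎_)
open import Function.Bundles using (_⇔_)
open import Function.Properties.Equivalence using (⇔-setoid)
open import Function.Construct.Symmetry using (⇔-sym)
open import Level using (0ℓ)
open import Relation.Binary.PropositionalEquality using (_≡_; _≢_; sym; cong)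
import Relation.Binary.Reasoning.Setoid as SetoidReasoning

corollary3p1 : (v λ′ r₁ r₂ : ℕ) (B : Blocks v) → IsRyserDesign v λ′ B →
    r₂ < r₁ → r₁ + r₂ ≡ suc v →
    (∀ (x : Fin v) → (replication B x ≡ r₁) ⊎ (replication B x ≡ r₂)) →
    (4 * λ′ ≤ suc v) ⇔
      ((+ 2) *ℤ ((+ pointsWithRep B r₁) - (+ r₂)) +ℤ (+ 1)
        ≤ℤ (+ pointsWithRep B r₂) - (+ pointsWithRep B r₁))
corollary3p1 v λ′ r₁ r₂ B design r₂<r₁ r₁+r₂≡1+v classes = begin
  4 * λ′ ≤ suc v                         ≈⟨ ℕ≤⇔ℤ≤ ⟩
  + (4 * λ′) ≤ℤ + suc v                  ≡⟨ cong (_≤ℤ + suc v) (pos-* 4 λ′) ⟩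
  + 4 *ℤ + λ′ ≤ℤ + suc v                 ≈⟨ ≤⇔0≤- ⟩
  + 0 ≤ℤ + suc v - + 4 *ℤ + λ′           ≈⟨ same-sign (0<n-m 1<v) (0<n-m r₂<r₁) linear-relation ⟩
  + 0 ≤ℤ + e₂ - + e₁ - (+ 2 *ℤ (+ e₁ - + r₂) +ℤ + 1)  ≈⟨ ⇔-sym ≤⇔0≤- ⟩
  + 2 *ℤ (+ e₁ - + r₂) +ℤ + 1 ≤ℤ + e₂ - + e₁ ∎
  where
  open SetoidReasoning (⇔-setoid 0ℓ)
  open IsRyserDesign design
  e₁ e₂ : ℕ
  e₁ = pointsWithRep B r₁
  e₂ = pointsWithRep B r₂
  r₁≢r₂ : r₁ ≢ r₂
  r₁≢r₂ r₁≡r₂ = ℕ.<-irrefl (sym r₁≡r₂) r₂<r₁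
  -- Two blocks of different sizes are in particular two distinct blocks.
  1<v : 1 < v
  1<v with twoSizes
  ... | i , j , sizes-differ = distinct⇒2≤n (λ i≡j → sizes-differ (cong (λ k → ∣ B k ∣) i≡j))
  linear-relation : (+ v - + 1) *ℤ (+ suc v - + 4 *ℤ + λ′)
                    ≡ (+ r₁ - + r₂) *ℤ (+ e₂ - + e₁ - (+ 2 *ℤ (+ e₁ - + r₂) +ℤ + 1))
  linear-relation = ryser-identity (+ e₁) (+ e₂) (+ r₁) (+ r₂) (+ v) (+ λ′)
    {{>-nonZero (+<+ (ℕ.<-trans z<s 1<v))}}
    (cong +_ (sym (class-sizes B r₁≢r₂ classes)))
    (a≡c-b {b = + r₂} (cong +_ r₁+r₂≡1+v))
    (counting-in-ℤ e₁ e₂ r₁ r₂ v λ′ (class-counting B intersect r₁≢r₂ classes))
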